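{- For every closed $\mathrm{BCCSP}_{\|}$ term $p$ there exists a BCCSP term $q$ (one with no occurrence of $\|$) such that $\mathcal{E}_{\mathtt{CS}}\vdash p\approx q$, where $\mathcal{E}_{\mathtt{CS}}=\mathcal{E}_1\cup\{\mathrm{CS},\mathrm{CSP1},\mathrm{CSP2},\mathrm{EL1}\}$.
   Context: Let $\mathcal{A}$ be a finite non-empty set of actions and $\mathcal{V}$ a countably infinite set of variables. $\mathrm{BCCSP}_{\|}$ terms: $t ::= \mathbf{0} \mid x \mid a.t \mid t+t \mid t \,\|\, t$ ($a\in\mathcal{A}$, $x \in \mathcal{V}$; $ax$ means $a.x$); BCCSP terms are those without $\|$; closed terms contain no variables. $\mathcal{E}\vdash t\approx u$: derivable in equational logic (reflexivity, symmetry, transitivity, substitution instances of axioms, closure under $a.\_$, $+$, $\|$). Axioms with concrete action names stand for all instances with actions from $\mathcal{A}$. $\mathcal{E}_1$: A0 $x+\mathbf{0}\approx x$; A1 $x+y\approx y+x$; A2 $(x+y)+z \approx x+(y+z)$; A3 $x+x\approx x$; P0 $x\|\mathbf{0}\approx x$; P1 $x\|y \approx y \| x$. CS: $a(bx+y+z)\approx a(bx+y+z)+a(bx+z)$. CSP1: $(ax+by+u)\|(cz+dw+v)\approx (ax+u)\|(cz+dw+v)+(by+u)\|(cz+dw+v)+(ax+by+u)\|(cz+v)+(ax+by+u)\|(dw+v)$. CSP2: $ax\|(by+cz+w)\approx a(x\|(by+cz+w))+ax\|(by+w)+ax\|(cz+w)$. EL1: $ax\|by\approx a(x\|by)+b(ax\|y)$.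 -}

module Defs where

open import Data.Nat using (ℕ)

Var : Set
Var = ℕ

infixr 7 _·_
infixl 5 _⊕_
infixl 6 _∥_
data Term (A : Set) : Set where
  𝟎   : Term A
  var : Var → Term A
  _·_ : A → Term A → Term A
  _⊕_ : Term A → Term A → Term A
  _∥_ : Term A → Term A → Term A

data Closed {A : Set} : Term A → Set where
  𝟎   : Closed 𝟎
  _·_ : ∀ a {t} → Closed t → Closed (a · t)
  _⊕_ : ∀ {t u} → Closed t → Closed u → Closed (t ⊕ u)
  _∥_ : ∀ {t u} → Closed t → Closed u → Closed (t ∥ u)

data BCCSP {A : Set} : Term A → Set where
  𝟎   : BCCSP 𝟎
  var : ∀ x → BCCSP (var x)
  _·_ : ∀ a {t} → BCCSP t → BCCSP (a · t)
  _⊕_ : ∀ {t u} → BCCSP t → BCCSP u → BCCSP (t ⊕ u)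

Subst : Set → Set
Subst A = Var → Term A

_[_] : {A : Set} → Term A → Subst A → Term A
𝟎 [ σ ] = 𝟎
var x [ σ ] = σ x
(a · t) [ σ ] = a · (t [ σ ])
(t ⊕ u) [ σ ] = (t [ σ ]) ⊕ (u [ σ ])
(t ∥ u) [ σ ] = (t [ σ ]) ∥ (u [ σ ])

module _ {A : Set} where
  x y z u v w : Term A
  x = var 0
  y = var 1
  z = var 2
  u = var 3
  v = var 4
  w = var 5

-- The axioms of E_CS = E_1 ∪ {CS, CSP1, CSP2, EL1}, each given as an
-- (lhs, rhs) pair; axioms with action names range over all actions.
data AxCS (A : Set) : Term A → Term A → Set where
  A0 : AxCS A (x ⊕ 𝟎) x
  A1 : AxCS A (x ⊕ y) (y ⊕ x)
  A2 : AxCS A ((x ⊕ y) ⊕ z) (x ⊕ (y ⊕ z))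
  A3 : AxCS A (x ⊕ x) x
  P0 : AxCS A (x ∥ 𝟎) x
  P1 : AxCS A (x ∥ y) (y ∥ x)
  CS : ∀ a b →
    AxCS A (a · (b · x ⊕ y ⊕ z))
           (a · (b · x ⊕ y ⊕ z) ⊕ a · (b · x ⊕ z))
  CSP1 : ∀ a b c d →
    AxCS A ((a · x ⊕ b · y ⊕ u) ∥ (c · z ⊕ d · w ⊕ v))
           ((a · x ⊕ u) ∥ (c · z ⊕ d · w ⊕ v)
            ⊕ (b · y ⊕ u) ∥ (c · z ⊕ d · w ⊕ v)
            ⊕ (a · x ⊕ b · y ⊕ u) ∥ (c · z ⊕ v)
            ⊕ (a · x ⊕ b · y ⊕ u) ∥ (d · w ⊕ v))
  CSP2 : ∀ a b c →
    AxCS A (a · x ∥ (b · y ⊕ c · z ⊕ w))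
           (a · (x ∥ (b · y ⊕ c · z ⊕ w))
            ⊕ a · x ∥ (b · y ⊕ w)
            ⊕ a · x ∥ (c · z ⊕ w))
  EL1 : ∀ a b →
    AxCS A (a · x ∥ b · y) (a · (x ∥ b · y) ⊕ b · (a · x ∥ y))

infix 4 _⊢_≈_
data _⊢_≈_ {A : Set} (E : Term A → Term A → Set) : Term A → Term A → Set where
  refl   : ∀ {t} → E ⊢ t ≈ t
  sym    : ∀ {t u} → E ⊢ t ≈ u → E ⊢ u ≈ t
  trans  : ∀ {t u r} → E ⊢ t ≈ u → E ⊢ u ≈ r → E ⊢ t ≈ r
  ax     : ∀ {l r} → E l r → (σ : Subst A) → E ⊢ (l [ σ ]) ≈ (r [ σ ])
  pref   : ∀ a {t u} → E ⊢ t ≈ u → E ⊢ a · t ≈ a · u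
  plus   : ∀ {t t' u u'} → E ⊢ t ≈ t' → E ⊢ u ≈ u' → E ⊢ t ⊕ u ≈ t' ⊕ u'
  par    : ∀ {t t' u u'} → E ⊢ t ≈ t' → E ⊢ u ≈ u' → E ⊢ t ∥ u ≈ t' ∥ u'

-- Every closed term is provably equal to a head normal form  a₁·t₁ + … + aₖ·tₖ  whose
-- bodies tᵢ are again head normal forms; such a term contains no ∥. Prefixing and
-- sums of head normal forms are handled by A0–A2. For a parallel composition P ∥ Q of
-- head normal forms, EL1 (both sides one summand), CSP2 (one side one summand) and
-- CSP1 (both sides at least two summands) rewrite it into prefixes and sums of parallel
-- compositions whose components have strictly smaller total size, so well-founded
-- recursion on that size puts P ∥ Q in head normal form.
module Submission where

open import Defs
open import Data.Nat using (ℕ; suc; _+_; _<_; s≤s)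
open import Data.Nat.Properties using (m≤m+n; m≤n+m; +-monoˡ-<; +-monoʳ-<)
open import Data.Nat.Induction using (<-wellFounded)
open import Data.Fin using (Fin)
open import Data.Product using (Σ; _×_; _,_)
open import Function using (_on_)
open import Induction.WellFounded using (Acc; acc)
open import Relation.Binary.Bundles using (Setoid)
open import Relation.Binary.Construct.On using (wellFounded)
import Relation.Binary.Reasoning.Setoid as SetoidReasoning

module HeadNormalForm (A : Set) where

  infix 4 _≋_
  _≋_ : Term A → Term A → Set
  t ≋ s = AxCS A ⊢ t ≈ s

  ≋-setoid : Setoid _ _
  ≋-setoid = record
    { Carrier       = Term A
    ; _≈_           = _≋_
    ; isEquivalence = record { refl = refl ; sym = sym ; trans = trans }
    }

  open SetoidReasoning ≋-setoid

  assign : (tx ty tz tu tv tw : Term A) → Subst A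
  assign tx ty tz tu tv tw 0 = tx
  assign tx ty tz tu tv tw 1 = ty
  assign tx ty tz tu tv tw 2 = tz
  assign tx ty tz tu tv tw 3 = tu
  assign tx ty tz tu tv tw 4 = tv
  assign tx ty tz tu tv tw 5 = tw
  assign tx ty tz tu tv tw (suc (suc (suc (suc (suc (suc _)))))) = 𝟎

  ⊕-identityʳ : ∀ t → t ⊕ 𝟎 ≋ t
  ⊕-identityʳ t = ax A0 (assign t 𝟎 𝟎 𝟎 𝟎 𝟎)

  ⊕-comm : ∀ t s → t ⊕ s ≋ s ⊕ t
  ⊕-comm t s = ax A1 (assign t s 𝟎 𝟎 𝟎 𝟎)

  ⊕-assoc : ∀ t s r → (t ⊕ s) ⊕ r ≋ t ⊕ (s ⊕ r)
  ⊕-assoc t s r = ax A2 (assign t s r 𝟎 𝟎 𝟎)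

  ⊕-identityˡ : ∀ t → 𝟎 ⊕ t ≋ t
  ⊕-identityˡ t = trans (⊕-comm 𝟎 t) (⊕-identityʳ t)

  ∥-identityʳ : ∀ t → t ∥ 𝟎 ≋ t
  ∥-identityʳ t = ax P0 (assign t 𝟎 𝟎 𝟎 𝟎 𝟎)

  ∥-comm : ∀ t s → t ∥ s ≋ s ∥ t
  ∥-comm t s = ax P1 (assign t s 𝟎 𝟎 𝟎 𝟎)

  ∥-identityˡ : ∀ t → 𝟎 ∥ t ≋ t
  ∥-identityˡ t = trans (∥-comm 𝟎 t) (∥-identityʳ t)

  el1 : ∀ a b tx ty → a · tx ∥ b · ty ≋ a · (tx ∥ b · ty) ⊕ b · (a · tx ∥ ty)
  el1 a b tx ty = ax (EL1 a b) (assign tx ty 𝟎 𝟎 𝟎 𝟎)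

  csp2 : ∀ a b c tx ty tz tw →
    a · tx ∥ (b · ty ⊕ c · tz ⊕ tw) ≋
      a · (tx ∥ (b · ty ⊕ c · tz ⊕ tw)) ⊕ a · tx ∥ (b · ty ⊕ tw) ⊕ a · tx ∥ (c · tz ⊕ tw)
  csp2 a b c tx ty tz tw = ax (CSP2 a b c) (assign tx ty tz 𝟎 𝟎 tw)

  csp1 : ∀ a b c d tx ty tz tu tv tw →
    (a · tx ⊕ b · ty ⊕ tu) ∥ (c · tz ⊕ d · tw ⊕ tv) ≋
      (a · tx ⊕ tu) ∥ (c · tz ⊕ d · tw ⊕ tv)
      ⊕ (b · ty ⊕ tu) ∥ (c · tz ⊕ d · tw ⊕ tv)
      ⊕ (a · tx ⊕ b · ty ⊕ tu) ∥ (c · tz ⊕ tv)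
      ⊕ (a · tx ⊕ b · ty ⊕ tu) ∥ (d · tw ⊕ tv)
  csp1 a b c d tx ty tz tu tv tw = ax (CSP1 a b c d) (assign tx ty tz tu tv tw)

  infixr 5 _·_∷_
  data NF : Set where
    nil   : NF
    _·_∷_ : A → NF → NF → NF

  ⌜_⌝ : NF → Term A
  ⌜ nil ⌝       = 𝟎
  ⌜ a · p ∷ r ⌝ = a · ⌜ p ⌝ ⊕ ⌜ r ⌝

  ⌜⌝-BCCSP : ∀ N → BCCSP ⌜ N ⌝
  ⌜⌝-BCCSP nil         = 𝟎
  ⌜⌝-BCCSP (a · p ∷ r) = (a · ⌜⌝-BCCSP p) ⊕ ⌜⌝-BCCSP r

  infixr 5 _++_
  _++_ : NF → NF → NF
  nil         ++ s = s
  (a · p ∷ r) ++ s = a · p ∷ (r ++ s)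

  ⌜⌝-++ : ∀ r s → ⌜ r ++ s ⌝ ≋ ⌜ r ⌝ ⊕ ⌜ s ⌝
  ⌜⌝-++ nil         s = sym (⊕-identityˡ ⌜ s ⌝)
  ⌜⌝-++ (a · p ∷ r) s = trans (plus refl (⌜⌝-++ r s)) (sym (⊕-assoc (a · ⌜ p ⌝) ⌜ r ⌝ ⌜ s ⌝))

  HasNF : Term A → Set
  HasNF t = Σ NF λ N → t ≋ ⌜ N ⌝

  nf-resp : ∀ {t s} → t ≋ s → HasNF s → HasNF t
  nf-resp t≋s (N , s≋N) = N , trans t≋s s≋N

  nf-· : ∀ a {t} → HasNF t → HasNF (a · t)
  nf-· a (N , t≋N) = a · N ∷ nil , trans (pref a t≋N) (sym (⊕-identityʳ _))

  nf-⊕ : ∀ {t s} → HasNF t → HasNF s → HasNF (t ⊕ s)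
  nf-⊕ (N , t≋N) (M , s≋M) = N ++ M , trans (plus t≋N s≋M) (sym (⌜⌝-++ N M))

  expand-EL1 : ∀ a p b q →
    ⌜ a · p ∷ nil ⌝ ∥ ⌜ b · q ∷ nil ⌝ ≋
      a · (⌜ p ⌝ ∥ ⌜ b · q ∷ nil ⌝) ⊕ b · (⌜ a · p ∷ nil ⌝ ∥ ⌜ q ⌝)
  expand-EL1 a p b q = begin
    (a · ⌜ p ⌝ ⊕ 𝟎) ∥ (b · ⌜ q ⌝ ⊕ 𝟎)
      ≈⟨ par (⊕-identityʳ _) (⊕-identityʳ _) ⟩
    a · ⌜ p ⌝ ∥ b · ⌜ q ⌝
      ≈⟨ el1 a b ⌜ p ⌝ ⌜ q ⌝ ⟩
    a · (⌜ p ⌝ ∥ b · ⌜ q ⌝) ⊕ b · (a · ⌜ p ⌝ ∥ ⌜ q ⌝)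
      ≈⟨ plus (pref a (par refl (sym (⊕-identityʳ _))))
              (pref b (par (sym (⊕-identityʳ _)) refl)) ⟩
    a · (⌜ p ⌝ ∥ (b · ⌜ q ⌝ ⊕ 𝟎)) ⊕ b · ((a · ⌜ p ⌝ ⊕ 𝟎) ∥ ⌜ q ⌝) ∎

  expand-CSP2 : ∀ a p b q c s r →
    let P = a · p ∷ nil ; Q = b · q ∷ c · s ∷ r in
    ⌜ P ⌝ ∥ ⌜ Q ⌝ ≋
      a · (⌜ p ⌝ ∥ ⌜ Q ⌝) ⊕ ⌜ P ⌝ ∥ ⌜ b · q ∷ r ⌝ ⊕ ⌜ P ⌝ ∥ ⌜ c · s ∷ r ⌝
  expand-CSP2 a p b q c s r = begin
    (a · ⌜ p ⌝ ⊕ 𝟎) ∥ (b · ⌜ q ⌝ ⊕ (c · ⌜ s ⌝ ⊕ ⌜ r ⌝))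
      ≈⟨ par (⊕-identityʳ _) (sym (⊕-assoc _ _ _)) ⟩
    a · ⌜ p ⌝ ∥ (b · ⌜ q ⌝ ⊕ c · ⌜ s ⌝ ⊕ ⌜ r ⌝)
      ≈⟨ csp2 a b c ⌜ p ⌝ ⌜ q ⌝ ⌜ s ⌝ ⌜ r ⌝ ⟩
    a · (⌜ p ⌝ ∥ (b · ⌜ q ⌝ ⊕ c · ⌜ s ⌝ ⊕ ⌜ r ⌝))
      ⊕ a · ⌜ p ⌝ ∥ (b · ⌜ q ⌝ ⊕ ⌜ r ⌝) ⊕ a · ⌜ p ⌝ ∥ (c · ⌜ s ⌝ ⊕ ⌜ r ⌝)
      ≈⟨ plus (plus (pref a (par refl (⊕-assoc _ _ _)))
                    (par (sym (⊕-identityʳ _)) refl))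
              (par (sym (⊕-identityʳ _)) refl) ⟩
    a · (⌜ p ⌝ ∥ (b · ⌜ q ⌝ ⊕ (c · ⌜ s ⌝ ⊕ ⌜ r ⌝)))
      ⊕ (a · ⌜ p ⌝ ⊕ 𝟎) ∥ (b · ⌜ q ⌝ ⊕ ⌜ r ⌝) ⊕ (a · ⌜ p ⌝ ⊕ 𝟎) ∥ (c · ⌜ s ⌝ ⊕ ⌜ r ⌝) ∎

  expand-CSP2-sym : ∀ a p b q r c s →
    let P = a · p ∷ b · q ∷ r ; Q = c · s ∷ nil in
    ⌜ P ⌝ ∥ ⌜ Q ⌝ ≋
      c · (⌜ P ⌝ ∥ ⌜ s ⌝) ⊕ ⌜ a · p ∷ r ⌝ ∥ ⌜ Q ⌝ ⊕ ⌜ b · q ∷ r ⌝ ∥ ⌜ Q ⌝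
  expand-CSP2-sym a p b q r c s = begin
    ⌜ P ⌝ ∥ ⌜ Q ⌝
      ≈⟨ ∥-comm _ _ ⟩
    ⌜ Q ⌝ ∥ ⌜ P ⌝
      ≈⟨ expand-CSP2 c s a p b q r ⟩
    c · (⌜ s ⌝ ∥ ⌜ P ⌝) ⊕ ⌜ Q ⌝ ∥ ⌜ a · p ∷ r ⌝ ⊕ ⌜ Q ⌝ ∥ ⌜ b · q ∷ r ⌝
      ≈⟨ plus (plus (pref c (∥-comm _ _)) (∥-comm _ _)) (∥-comm _ _) ⟩
    c · (⌜ P ⌝ ∥ ⌜ s ⌝) ⊕ ⌜ a · p ∷ r ⌝ ∥ ⌜ Q ⌝ ⊕ ⌜ b · q ∷ r ⌝ ∥ ⌜ Q ⌝ ∎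
    where
    P = a · p ∷ b · q ∷ r
    Q = c · s ∷ nil

  expand-CSP1 : ∀ a p b q r c s d t r′ →
    let P = a · p ∷ b · q ∷ r ; Q = c · s ∷ d · t ∷ r′ in
    ⌜ P ⌝ ∥ ⌜ Q ⌝ ≋
      ⌜ a · p ∷ r ⌝ ∥ ⌜ Q ⌝ ⊕ ⌜ b · q ∷ r ⌝ ∥ ⌜ Q ⌝
      ⊕ ⌜ P ⌝ ∥ ⌜ c · s ∷ r′ ⌝ ⊕ ⌜ P ⌝ ∥ ⌜ d · t ∷ r′ ⌝
  expand-CSP1 a p b q r c s d t r′ = begin
    (a · ⌜ p ⌝ ⊕ (b · ⌜ q ⌝ ⊕ ⌜ r ⌝)) ∥ (c · ⌜ s ⌝ ⊕ (d · ⌜ t ⌝ ⊕ ⌜ r′ ⌝))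
      ≈⟨ par (sym (⊕-assoc _ _ _)) (sym (⊕-assoc _ _ _)) ⟩
    (a · ⌜ p ⌝ ⊕ b · ⌜ q ⌝ ⊕ ⌜ r ⌝) ∥ (c · ⌜ s ⌝ ⊕ d · ⌜ t ⌝ ⊕ ⌜ r′ ⌝)
      ≈⟨ csp1 a b c d ⌜ p ⌝ ⌜ q ⌝ ⌜ s ⌝ ⌜ r ⌝ ⌜ r′ ⌝ ⌜ t ⌝ ⟩
    (a · ⌜ p ⌝ ⊕ ⌜ r ⌝) ∥ (c · ⌜ s ⌝ ⊕ d · ⌜ t ⌝ ⊕ ⌜ r′ ⌝)
      ⊕ (b · ⌜ q ⌝ ⊕ ⌜ r ⌝) ∥ (c · ⌜ s ⌝ ⊕ d · ⌜ t ⌝ ⊕ ⌜ r′ ⌝)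
      ⊕ (a · ⌜ p ⌝ ⊕ b · ⌜ q ⌝ ⊕ ⌜ r ⌝) ∥ (c · ⌜ s ⌝ ⊕ ⌜ r′ ⌝)
      ⊕ (a · ⌜ p ⌝ ⊕ b · ⌜ q ⌝ ⊕ ⌜ r ⌝) ∥ (d · ⌜ t ⌝ ⊕ ⌜ r′ ⌝)
      ≈⟨ plus (plus (plus (par refl (⊕-assoc _ _ _)) (par refl (⊕-assoc _ _ _)))
                    (par (⊕-assoc _ _ _) refl))
              (par (⊕-assoc _ _ _) refl) ⟩
    ⌜ a · p ∷ r ⌝ ∥ ⌜ Q ⌝ ⊕ ⌜ b · q ∷ r ⌝ ∥ ⌜ Q ⌝
      ⊕ ⌜ P ⌝ ∥ ⌜ c · s ∷ r′ ⌝ ⊕ ⌜ P ⌝ ∥ ⌜ d · t ∷ r′ ⌝ ∎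
    where
    P = a · p ∷ b · q ∷ r
    Q = c · s ∷ d · t ∷ r′

  size : NF → ℕ
  size nil         = 0
  size (a · p ∷ r) = suc (size p + size r)

  size-body : ∀ a p r → size p < size (a · p ∷ r)
  size-body a p r = s≤s (m≤m+n (size p) (size r))

  size-drop₁ : ∀ a p b q r → size (b · q ∷ r) < size (a · p ∷ b · q ∷ r)
  size-drop₁ a p b q r = s≤s (m≤n+m (size (b · q ∷ r)) (size p))

  size-drop₂ : ∀ a p b q r → size (a · p ∷ r) < size (a · p ∷ b · q ∷ r)
  size-drop₂ a p b q r = s≤s (+-monoʳ-< (size p) (s≤s (m≤n+m (size r) (size q))))

  _⊏_ : NF × NF → NF × NF → Set
  _⊏_ = _<_ on λ { (P , Q) → size P + size Q }

  shrink-left : ∀ {P′ P Q} → size P′ < size P → Acc _⊏_ (P , Q) → Acc _⊏_ (P′ , Q)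
  shrink-left {Q = Q} lt (acc rec) = rec (+-monoˡ-< (size Q) lt)

  shrink-right : ∀ {P Q′ Q} → size Q′ < size Q → Acc _⊏_ (P , Q) → Acc _⊏_ (P , Q′)
  shrink-right {P = P} lt (acc rec) = rec (+-monoʳ-< (size P) lt)

  nf-∥ : ∀ P Q → Acc _⊏_ (P , Q) → HasNF (⌜ P ⌝ ∥ ⌜ Q ⌝)
  nf-∥ nil Q _ = Q , ∥-identityˡ ⌜ Q ⌝
  nf-∥ P@(_ · _ ∷ _) nil _ = P , ∥-identityʳ ⌜ P ⌝
  nf-∥ P@(a · p ∷ nil) Q@(b · q ∷ nil) wf =
    nf-resp (expand-EL1 a p b q)
      (nf-⊕ (nf-· a (nf-∥ p Q (shrink-left (size-body a p nil) wf)))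
            (nf-· b (nf-∥ P q (shrink-right (size-body b q nil) wf))))
  nf-∥ P@(a · p ∷ nil) Q@(b · q ∷ c · s ∷ r) wf =
    nf-resp (expand-CSP2 a p b q c s r)
      (nf-⊕ (nf-⊕ (nf-· a (nf-∥ p Q (shrink-left (size-body a p nil) wf)))
                  (nf-∥ P (b · q ∷ r) (shrink-right (size-drop₂ b q c s r) wf)))
            (nf-∥ P (c · s ∷ r) (shrink-right (size-drop₁ b q c s r) wf)))
  nf-∥ P@(a · p ∷ b · q ∷ r) Q@(c · s ∷ nil) wf =
    nf-resp (expand-CSP2-sym a p b q r c s)
      (nf-⊕ (nf-⊕ (nf-· c (nf-∥ P s (shrink-right (size-body c s nil) wf)))
                  (nf-∥ (a · p ∷ r) Q (shrink-left (size-drop₂ a p b q r) wf)))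
            (nf-∥ (b · q ∷ r) Q (shrink-left (size-drop₁ a p b q r) wf)))
  nf-∥ P@(a · p ∷ b · q ∷ r) Q@(c · s ∷ d · t ∷ r′) wf =
    nf-resp (expand-CSP1 a p b q r c s d t r′)
      (nf-⊕ (nf-⊕ (nf-⊕ (nf-∥ (a · p ∷ r) Q (shrink-left (size-drop₂ a p b q r) wf))
                        (nf-∥ (b · q ∷ r) Q (shrink-left (size-drop₁ a p b q r) wf)))
                  (nf-∥ P (c · s ∷ r′) (shrink-right (size-drop₂ c s d t r′) wf)))
            (nf-∥ P (d · t ∷ r′) (shrink-right (size-drop₁ c s d t r′) wf)))

  ⊏-wellFounded : ∀ PQ → Acc _⊏_ PQ
  ⊏-wellFounded = wellFounded _ <-wellFounded

  normalise : ∀ {t} → Closed t → HasNF t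
  normalise 𝟎         = nil , refl
  normalise (a · ct)  = nf-· a (normalise ct)
  normalise (ct ⊕ cs) = nf-⊕ (normalise ct) (normalise cs)
  normalise (ct ∥ cs) with normalise ct | normalise cs
  ... | N , t≋N | M , s≋M = nf-resp (par t≋N s≋M) (nf-∥ N M (⊏-wellFounded (N , M)))

proposition4p2 : (n : ℕ) (p : Term (Fin (suc n))) → Closed p →
    Σ (Term (Fin (suc n))) (λ q → BCCSP q × (AxCS (Fin (suc n)) ⊢ p ≈ q))
proposition4p2 n p cp = let N , p≋N = normalise cp in ⌜ N ⌝ , ⌜⌝-BCCSP N , p≋N
  where open HeadNormalForm (Fin (suc n))
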